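{- Let $H$ be the Hoffman–Singleton graph (the strongly regular graph with parameters $(50,7,0,1)$) and let $\pi$ be a partition of its vertex set into the vertex sets of 5 vertex-disjoint induced copies of the Petersen graph. Then $\pi$ is a good partition for $H$, and for every positive integer $j$ there exists a directed strongly regular graph with parameter set $(250j+50,\,50j+7,\,10j+7,\,10j,\,10j+1)$.
   Context: A directed strongly regular graph (DSRG) with parameters $(n,k,t,\lambda,\mu)$ is a loopless digraph on $n$ vertices whose adjacency matrix $A$ satisfies $AJ=JA=kJ$ and $A^2=tI+\lambda A+\mu(J-I-A)$; an undirected SRG $(n,k,\lambda,\mu)$ is regarded as a DSRG $(n,k,k,\lambda,\mu)$. For a homogeneous partition $\pi=\{C_1,\dots,C_a\}$ (all cells of equal size), the $\pi$-join $\Gamma^1_\pi$ has vertex set $V(\Gamma)\times\{0,\dots,a\}$ and arcs $(u,r)\to(v,r)$ whenever $u\to v$ in $\Gamma$, and, for every $(u,r)$ and every $i$, arcs from $(u,r)$ to all $(v,r+i\bmod (a+1))$ with $v\in C_i$; $\pi$ is good for $\Gamma$ if $\Gamma^1_\pi$ is a DSRG. -}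

module Defs where

open import Data.Nat using (ℕ; zero; suc; _+_; _*_; _%_; _≡ᵇ_)
open import Data.Fin using (Fin; zero; suc; toℕ; remQuot; fromℕ<)
open import Data.Fin.Properties using (_≟_)
open import Data.Bool using (Bool; true; false; _∧_; _∨_; not; if_then_else_)
open import Data.Product using (_×_; _,_; Σ; ∃; proj₁; proj₂)
open import Relation.Nullary.Decidable using (⌊_⌋)
open import Relation.Binary.PropositionalEquality using (_≡_; _≢_)
open import Function using (_∘_)
open import Function.Definitions using (Injective)

-- A digraph on the vertex set Fin n, given by its 0/1 adjacency matrix
-- (A x y ≡ true  iff  there is an arc x → y).
Digraph : ℕ → Set
Digraph n = Fin n → Fin n → Bool

count : ∀ {n} → (Fin n → Bool) → ℕ
count {zero}  f = 0
count {suc n} f = (if f zero then 1 else 0) + count (f ∘ suc)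

-- Directed strongly regular graph with parameters (n,k,t,λ,μ):
-- loopless, AJ = JA = kJ, and A² = tI + λA + μ(J - I - A), written entrywise.
record IsDSRG (n k t λ′ μ : ℕ) (A : Digraph n) : Set where
  field
    loopless  : ∀ x → A x x ≡ false
    outDegree : ∀ x → count (λ y → A x y) ≡ k
    inDegree  : ∀ y → count (λ x → A x y) ≡ k
    diag      : ∀ x → count (λ z → A x z ∧ A z x) ≡ t
    arc       : ∀ x y → x ≢ y → A x y ≡ true →
                count (λ z → A x z ∧ A z y) ≡ λ′
    nonarc    : ∀ x y → x ≢ y → A x y ≡ false →
                count (λ z → A x z ∧ A z y) ≡ μ

record IsSRG (n k λ′ μ : ℕ) (A : Digraph n) : Set where
  field
    symmetric : ∀ x y → A x y ≡ A y x
    isDSRG    : IsDSRG n k k λ′ μ A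

IsDSRGAny : ∀ {n} → Digraph n → Set
IsDSRGAny {n} A = Σ ℕ λ k → Σ ℕ λ t → Σ ℕ λ l → Σ ℕ λ m → IsDSRG n k t l m A

-- A partition π = {C_1,…,C_a} of Fin n is given by cell : Fin n → Fin a,
-- where vertex v lies in C_i with i = toℕ (cell v) + 1.
-- π-join: vertex set Fin n × Fin (a+1), encoded as Fin (n * suc a) via remQuot.
-- (u,r) → (v,s)  iff  (s = r and u → v)  or  s ≡ r + i (mod a+1) where v ∈ C_i.
joinArc : ∀ {n a} → Digraph n → (Fin n → Fin a) →
          Fin n × Fin (suc a) → Fin n × Fin (suc a) → Bool
joinArc {n} {a} A cell (u , r) (v , s) =
  (⌊ r ≟ s ⌋ ∧ A u v) ∨
  (toℕ s ≡ᵇ ((toℕ r + suc (toℕ (cell v))) % suc a))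

piJoin : ∀ {n a} → Digraph n → (Fin n → Fin a) → Digraph (n * suc a)
piJoin {n} {a} A cell x y =
  joinArc A cell (remQuot (suc a) x) (remQuot (suc a) y)

IsGood : ∀ {n a} → Digraph n → (Fin n → Fin a) → Set
IsGood A cell = IsDSRGAny (piJoin A cell)

-- Petersen graph = Kneser graph K(5,2): vertices are the 2-subsets of {0..4},
-- adjacent iff disjoint.
petersenPair : Fin 10 → Fin 5 × Fin 5
petersenPair i = table (toℕ i)
  where
  f : ℕ → Fin 5
  f 0 = zero
  f 1 = suc zero
  f 2 = suc (suc zero)
  f 3 = suc (suc (suc zero))
  f _ = suc (suc (suc (suc zero)))
  table : ℕ → Fin 5 × Fin 5
  table 0 = f 0 , f 1
  table 1 = f 0 , f 2
  table 2 = f 0 , f 3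
  table 3 = f 0 , f 4
  table 4 = f 1 , f 2
  table 5 = f 1 , f 3
  table 6 = f 1 , f 4
  table 7 = f 2 , f 3
  table 8 = f 2 , f 4
  table _ = f 3 , f 4

petersen : Digraph 10
petersen i j with petersenPair i | petersenPair j
... | (a , b) | (c , d) =
  not (⌊ a ≟ c ⌋ ∨ ⌊ a ≟ d ⌋ ∨ ⌊ b ≟ c ⌋ ∨ ⌊ b ≟ d ⌋)

InducedPetersenCell : ∀ {n a} → Digraph n → (Fin n → Fin a) → Fin a → Set
InducedPetersenCell {n} A cell i =
  Σ (Fin 10 → Fin n) λ f →
    Injective _≡_ _≡_ f ×
    (∀ p → cell (f p) ≡ i) ×
    (∀ v → cell v ≡ i → ∃ λ p → f p ≡ v) ×
    (∀ p q → A (f p) (f q) ≡ petersen p q)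

module Submission where

-- Given a DSRG A and a partition of its vertices into a cells, take m copies
-- (layers) of A and, between distinct layers r → s, add all arcs from layer r
-- to one cell of layer s, chosen by a layer pattern.  If the partition is
-- equitable (cells of equal size, constant numbers of in-neighbours in the own
-- cell and in each other cell) and the pattern sends into every cell of every
-- layer arcs from the same number j of layers, the result is again a DSRG:
-- counting walks of length two layer by layer gives one identity (walkCount)
-- from which all the DSRG conditions follow (LayeredJoin.isDSRG).
--
-- Finally the Petersen
-- cells of H are shown to form an equitable partition (each vertex has 3
-- neighbours in its own cell and exactly 1 in each other cell, since H has no
-- triangles and no 4-cycles), and the theorem is assembled from these pieces.

open import Defs
open import Data.Nat using (ℕ; zero; suc; _+_; _*_; _%_; _≡ᵇ_; _≤_; z≤n; s≤s)
import Data.Nat as ℕ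
open import Data.Nat.Properties
  using (+-*-semiring; +-assoc; +-identityʳ; *-identityˡ; *-identityʳ; *-comm; +-mono-≤; +-monoʳ-≤;
         +-cancelˡ-≡; +-cancelʳ-≡; +-cancelʳ-≤; ≤-antisym; ≤-refl; ≤-trans; ≤-reflexive; m≤m+n; <⇒≱;
         module ≤-Reasoning)
open import Data.Nat.Tactic.RingSolver using (solve-∀)
open import Data.Fin using (Fin; zero; suc; toℕ; _↑ˡ_; _↑ʳ_; combine; remQuot; punchIn; punchOut)
open import Data.Fin.Properties
  using (_≟_; all?; any?; suc-injective; 0≢1+n; remQuot-combine; combine-remQuot;
         punchInᵢ≢i; punchIn-punchOut; punchOut-punchIn; punchOut-cong)
open import Data.Bool using (Bool; true; false; _∧_; _∨_; if_then_else_)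
import Data.Bool.Properties as Bool
open import Data.Empty using (⊥; ⊥-elim)
open import Data.Product using (_×_; _,_; Σ; ∃; proj₁; proj₂)
open import Data.Sum using (_⊎_; inj₁; inj₂; [_,_]′)
open import Data.Unit using (tt)
open import Function using (_∘_; id)
open import Function.Definitions using (Injective)
open import Relation.Nullary using (yes; no)
open import Relation.Nullary.Decidable
  using (⌊_⌋; isYes≗does; dec-true; dec-false; toSum; toWitness; decidable-stable; _⊎-dec_; _×-dec_)
open import Relation.Binary.PropositionalEquality
  using (_≡_; _≢_; refl; sym; trans; cong; cong₂; subst; module ≡-Reasoning)
open import Algebra.Properties.Semiring.Sum +-*-semiring
  using (sum; sum-cong-≗; sum-remove; sum-replicate-zero; ∑-distrib-+; ∑-comm; *-distribˡ-sum; *-distribʳ-sum)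

⟦_⟧ : Bool → ℕ
⟦ b ⟧ = if b then 1 else 0

δ : ∀ {n} → Fin n → Fin n → ℕ
δ i j = ⟦ ⌊ i ≟ j ⌋ ⟧

≟-diag : ∀ {n} (i : Fin n) → ⌊ i ≟ i ⌋ ≡ true
≟-diag i = trans (isYes≗does (i ≟ i)) (dec-true (i ≟ i) refl)

≟-off : ∀ {n} {i j : Fin n} → i ≢ j → ⌊ i ≟ j ⌋ ≡ false
≟-off {i = i} {j} i≢j = trans (isYes≗does (i ≟ j)) (dec-false (i ≟ j) i≢j)

≟-true : ∀ {n} {i j : Fin n} → ⌊ i ≟ j ⌋ ≡ true → i ≡ j
≟-true {i = i} {j} eq with i ≟ j
≟-true eq | yes i≡j = i≡j
≟-true () | no _

δ-diag : ∀ {n} (i : Fin n) → δ i i ≡ 1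
δ-diag i = cong ⟦_⟧ (≟-diag i)

δ-off : ∀ {n} {i j : Fin n} → i ≢ j → δ i j ≡ 0
δ-off i≢j = cong ⟦_⟧ (≟-off i≢j)

⟦∧⟧ : ∀ a b → ⟦ a ∧ b ⟧ ≡ ⟦ a ⟧ * ⟦ b ⟧
⟦∧⟧ false b = refl
⟦∧⟧ true  b = sym (+-identityʳ ⟦ b ⟧)

count≡sum : ∀ {n} (f : Fin n → Bool) → count f ≡ sum (⟦_⟧ ∘ f)
count≡sum {zero}  f = refl
count≡sum {suc n} f = cong (⟦ f zero ⟧ +_) (count≡sum (f ∘ suc))

count-cong : ∀ {n} {f g : Fin n → Bool} → (∀ i → f i ≡ g i) → count f ≡ count g
count-cong {f = f} {g} f≗g = begin
  count f           ≡⟨ count≡sum f ⟩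
  sum (⟦_⟧ ∘ f)     ≡⟨ sum-cong-≗ (cong ⟦_⟧ ∘ f≗g) ⟩
  sum (⟦_⟧ ∘ g)     ≡⟨ count≡sum g ⟨
  count g           ∎
  where open ≡-Reasoning

count-false : ∀ {n} {f : Fin n → Bool} → (∀ i → f i ≡ false) → count f ≡ 0
count-false {zero}  never = refl
count-false {suc n} {f} never rewrite never zero = count-false (never ∘ suc)

count-∧ : ∀ {n} (f g : Fin n → Bool) → count (λ i → f i ∧ g i) ≡ sum (λ i → ⟦ f i ⟧ * ⟦ g i ⟧)
count-∧ f g = trans (count≡sum (λ i → f i ∧ g i)) (sum-cong-≗ (λ i → ⟦∧⟧ (f i) (g i)))

count-remove : ∀ {n} (g : Fin (suc n) → Bool) x → count g ≡ ⟦ g x ⟧ + count (g ∘ punchIn x)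
count-remove g x = trans (count≡sum g)
  (trans (sum-remove {i = x} (⟦_⟧ ∘ g)) (cong (⟦ g x ⟧ +_) (sym (count≡sum (g ∘ punchIn x)))))

count-≥1 : ∀ {n} (g : Fin n → Bool) {x} → g x ≡ true → 1 ≤ count g
count-≥1 {suc n} g {x} gx =
  ≤-trans (m≤m+n 1 _)
          (≤-reflexive (sym (trans (count-remove g x) (cong (λ b → ⟦ b ⟧ + count (g ∘ punchIn x)) gx))))

count-≥2 : ∀ {n} (g : Fin n → Bool) {x y} → x ≢ y → g x ≡ true → g y ≡ true → 2 ≤ count g
count-≥2 {suc n} g {x} {y} x≢y gx gy =
  ≤-trans (s≤s (count-≥1 (g ∘ punchIn x) {punchOut x≢y} (trans (cong g (punchIn-punchOut x≢y)) gy)))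
          (≤-reflexive (sym (trans (count-remove g x) (cong (λ b → ⟦ b ⟧ + count (g ∘ punchIn x)) gx))))

count-≤1 : ∀ {n} (g : Fin n → Bool) → (∀ x y → g x ≡ true → g y ≡ true → x ≡ y) → count g ≤ 1
count-≤1 {zero}  g unique = z≤n
count-≤1 {suc n} g unique with g zero in g₀
... | true  = s≤s (≤-reflexive (count-false (λ x → Bool.¬-not (λ gx → 0≢1+n (unique zero (suc x) g₀ gx)))))
... | false = count-≤1 (g ∘ suc) (λ x y gx gy → suc-injective (unique (suc x) (suc y) gx gy))

∑-const : ∀ {n} c → sum {n} (λ _ → c) ≡ n * c
∑-const {zero}  c = refl
∑-const {suc n} c = cong (c +_) (∑-const {n} c)

∑-zero : ∀ {n} (f : Fin n → ℕ) → (∀ i → f i ≡ 0) → sum f ≡ 0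
∑-zero {n} f vanish = trans (sum-cong-≗ vanish) (sum-replicate-zero n)

∑-single : ∀ {n} (i : Fin n) (f : Fin n → ℕ) → (∀ j → j ≢ i → f j ≡ 0) → sum f ≡ f i
∑-single {suc n} i f vanish = begin
  sum f                        ≡⟨ sum-remove {i = i} f ⟩
  f i + sum (f ∘ punchIn i)    ≡⟨ cong (f i +_) (∑-zero _ (λ j → vanish _ (punchInᵢ≢i i j))) ⟩
  f i + 0                      ≡⟨ +-identityʳ (f i) ⟩
  f i                          ∎
  where open ≡-Reasoning

∑-δˡ : ∀ {n} (i : Fin n) (f : Fin n → ℕ) → sum (λ j → δ i j * f j) ≡ f i
∑-δˡ i f = trans (∑-single i _ (λ j j≢i → cong (_* f j) (δ-off (j≢i ∘ sym))))
                 (trans (cong (_* f i) (δ-diag i)) (+-identityʳ (f i)))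

∑-δʳ : ∀ {n} (i : Fin n) (f : Fin n → ℕ) → sum (λ j → δ j i * f j) ≡ f i
∑-δʳ i f = trans (∑-single i _ (λ j j≢i → cong (_* f j) (δ-off j≢i)))
                 (trans (cong (_* f i) (δ-diag i)) (+-identityʳ (f i)))

∑-δ : ∀ {n} (i : Fin n) → sum (δ i) ≡ 1
∑-δ i = trans (sum-cong-≗ (λ j → sym (*-identityʳ (δ i j)))) (∑-δˡ i (λ _ → 1))

∑-*ˡ : ∀ {n} c (f : Fin n → ℕ) → sum (λ i → c * f i) ≡ c * sum f
∑-*ˡ c f = sym (*-distribˡ-sum c f)

∑-*ʳ : ∀ {n} c (f : Fin n → ℕ) → sum (λ i → f i * c) ≡ sum f * c
∑-*ʳ c f = sym (*-distribʳ-sum c f)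

∑-bounded : ∀ {n} c (f : Fin n → ℕ) → (∀ i → f i ≤ c) → sum f ≤ n * c
∑-bounded {zero}  c f bound = z≤n
∑-bounded {suc n} c f bound = +-mono-≤ (bound zero) (∑-bounded c (f ∘ suc) (bound ∘ suc))

saturated : ∀ {n} (f : Fin n → ℕ) → (∀ i → f i ≤ 1) → sum f ≡ n → ∀ i → f i ≡ 1
saturated {suc n} f atMostOne total i = ≤-antisym (atMostOne i) (+-cancelʳ-≤ n 1 (f i) lower)
  where
  open ≤-Reasoning
  lower : 1 + n ≤ f i + n
  lower = begin
    suc n                       ≡⟨ total ⟨
    sum f                       ≡⟨ sum-remove {i = i} f ⟩
    f i + sum (f ∘ punchIn i)   ≤⟨ +-monoʳ-≤ (f i) (∑-bounded 1 _ (atMostOne ∘ punchIn i)) ⟩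
    f i + n * 1                 ≡⟨ cong (f i +_) (*-identityʳ n) ⟩
    f i + n                     ∎

∑-++ : ∀ m {k} (g : Fin (m + k) → ℕ) → sum g ≡ sum (λ i → g (i ↑ˡ k)) + sum (λ i → g (m ↑ʳ i))
∑-++ zero    g = refl
∑-++ (suc m) g = trans (cong (g zero +_) (∑-++ m (g ∘ suc))) (sym (+-assoc (g zero) _ _))

∑-combine : ∀ {n m} (g : Fin (n * m) → ℕ) → sum g ≡ sum {n} (λ u → sum {m} (λ r → g (combine u r)))
∑-combine {zero}      g = refl
∑-combine {suc n} {m} g =
  trans (∑-++ m g) (cong (sum (λ r → g (r ↑ˡ (n * m))) +_) (∑-combine {n} (λ x → g (m ↑ʳ x))))

∑-remQuot : ∀ {n m} (h : Fin n × Fin m → ℕ) →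
            sum {n * m} (λ x → h (remQuot m x)) ≡ sum (λ u → sum (λ r → h (u , r)))
∑-remQuot {n} {m} h = trans (∑-combine {n} (λ x → h (remQuot m x)))
  (sum-cong-≗ (λ u → sum-cong-≗ (λ r → cong h (remQuot-combine u r))))

count-pairs : ∀ {n m} (g : Fin n × Fin m → Bool) →
              count {n * m} (λ x → g (remQuot m x)) ≡ sum (λ q → sum (λ w → ⟦ g (w , q) ⟧))
count-pairs {n} {m} g = begin
  count {n * m} (λ x → g (remQuot m x))        ≡⟨ count≡sum {n * m} _ ⟩
  sum {n * m} (λ x → ⟦ g (remQuot m x) ⟧)      ≡⟨ ∑-remQuot (⟦_⟧ ∘ g) ⟩
  sum (λ w → sum (λ q → ⟦ g (w , q) ⟧))        ≡⟨ ∑-comm (λ w q → ⟦ g (w , q) ⟧) ⟩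
  sum (λ q → sum (λ w → ⟦ g (w , q) ⟧))        ∎
  where open ≡-Reasoning

∑-cells : ∀ {n a} (cell : Fin n → Fin a) (g : Fin n → Bool) →
          sum (λ i → count (λ w → ⌊ cell w ≟ i ⌋ ∧ g w)) ≡ count g
∑-cells cell g = begin
  sum (λ i → count (λ w → ⌊ cell w ≟ i ⌋ ∧ g w))   ≡⟨ sum-cong-≗ (λ i → count-∧ (λ w → ⌊ cell w ≟ i ⌋) g) ⟩
  sum (λ i → sum (λ w → δ (cell w) i * ⟦ g w ⟧))   ≡⟨ ∑-comm (λ i w → δ (cell w) i * ⟦ g w ⟧) ⟩
  sum (λ w → sum (λ i → δ (cell w) i * ⟦ g w ⟧))   ≡⟨ sum-cong-≗ (λ w → ∑-δˡ (cell w) (λ _ → ⟦ g w ⟧)) ⟩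
  sum (⟦_⟧ ∘ g)                                     ≡⟨ count≡sum g ⟨
  count g                                           ∎
  where open ≡-Reasoning

module _ {k n} (f : Fin k → Fin n) (f-injective : Injective _≡_ _≡_ f)
         (P : Fin n → Bool) (f-into : ∀ p → P (f p) ≡ true)
         (f-onto : ∀ w → P w ≡ true → ∃ λ p → f p ≡ w) where

  fibreSize : ∀ w → ⟦ P w ⟧ ≡ sum (λ p → δ (f p) w)
  fibreSize w with P w in Pw
  ... | true  = let (p₀ , fp₀≡w) = f-onto w Pw in sym (begin
    sum (λ p → δ (f p) w)   ≡⟨ ∑-single p₀ _ (λ p p≢p₀ → δ-off (p≢p₀ ∘ f-injective ∘ λ e → trans e (sym fp₀≡w))) ⟩
    δ (f p₀) w              ≡⟨ cong (λ z → δ z w) fp₀≡w ⟩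
    δ w w                   ≡⟨ δ-diag w ⟩
    1                       ∎)
    where open ≡-Reasoning
  ... | false = sym (∑-zero _ (λ p → δ-off (λ fp≡w → outside p fp≡w)))
    where
    outside : ∀ p → f p ≢ w
    outside p refl with () ← trans (sym Pw) (f-into p)

  count-image : (g : Fin n → Bool) → count (λ w → P w ∧ g w) ≡ count (g ∘ f)
  count-image g = begin
    count (λ w → P w ∧ g w)                        ≡⟨ count-∧ P g ⟩
    sum (λ w → ⟦ P w ⟧ * ⟦ g w ⟧)                  ≡⟨ sum-cong-≗ (λ w → cong (_* ⟦ g w ⟧) (fibreSize w)) ⟩
    sum (λ w → sum (λ p → δ (f p) w) * ⟦ g w ⟧)    ≡⟨ sum-cong-≗ (λ w → ∑-*ʳ ⟦ g w ⟧ (λ p → δ (f p) w)) ⟨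
    sum (λ w → sum (λ p → δ (f p) w * ⟦ g w ⟧))    ≡⟨ ∑-comm (λ w p → δ (f p) w * ⟦ g w ⟧) ⟩
    sum (λ p → sum (λ w → δ (f p) w * ⟦ g w ⟧))    ≡⟨ sum-cong-≗ (λ p → ∑-δˡ (f p) (⟦_⟧ ∘ g)) ⟩
    sum (⟦_⟧ ∘ g ∘ f)                              ≡⟨ count≡sum (g ∘ f) ⟨
    count (g ∘ f)                                  ∎
    where open ≡-Reasoning

∑-expand : ∀ {n} x y c (f g h : Fin n → ℕ) →
  sum (λ w → (x * f w + g w) * (y * h w + c))
    ≡ x * (y * sum (λ w → f w * h w)) + x * (c * sum f) + y * sum (λ w → g w * h w) + c * sum g
∑-expand {zero}  x y c f g h = base x y c
  where
  base : ∀ x y c → 0 ≡ x * (y * 0) + x * (c * 0) + y * 0 + c * 0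
  base = solve-∀
∑-expand {suc n} x y c f g h =
  trans (cong ((x * f zero + g zero) * (y * h zero + c) +_) (∑-expand x y c (f ∘ suc) (g ∘ suc) (h ∘ suc)))
        (step x y c (f zero) (g zero) (h zero) _ _ _ _)
  where
  step : ∀ x y c f₀ g₀ h₀ Σfh Σf Σgh Σg →
    (x * f₀ + g₀) * (y * h₀ + c) + (x * (y * Σfh) + x * (c * Σf) + y * Σgh + c * Σg)
      ≡ x * (y * (f₀ * h₀ + Σfh)) + x * (c * (f₀ + Σf)) + y * (g₀ * h₀ + Σgh) + c * (g₀ + Σg)
  step = solve-∀

record EquitablePartition {n a} (A : Digraph n) (cell : Fin n → Fin a) (size own other : ℕ) : Set where
  field
    cellSize  : ∀ i → count (λ w → ⌊ cell w ≟ i ⌋) ≡ size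
    ownCell   : ∀ v → count (λ w → ⌊ cell w ≟ cell v ⌋ ∧ A w v) ≡ own
    otherCell : ∀ v i → i ≢ cell v → count (λ w → ⌊ cell w ≟ i ⌋ ∧ A w v) ≡ other

-- How m layers (copies of the vertex set) are joined: `label r s c` says that
-- every vertex of layer r has arcs to all vertices of cell c in layer s.
record LayerPattern (m a j : ℕ) : Set where
  field
    label       : Fin m → Fin m → Fin a → Bool
    irreflexive : ∀ r c → label r r c ≡ false
    oneCell     : ∀ r s → r ≢ s → ∃ λ i → ∀ c → label r s c ≡ ⌊ c ≟ i ⌋
    inLayers    : ∀ s c → count (λ r → label r s c) ≡ j

layerArc : ∀ {n a m} → Digraph n → (Fin n → Fin a) → (Fin m → Fin m → Fin a → Bool) →
           Fin n × Fin m → Fin n × Fin m → Bool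
layerArc A cell label (u , r) (w , q) = (⌊ r ≟ q ⌋ ∧ A u w) ∨ label r q (cell w)

layeredJoin : ∀ {n a m} → Digraph n → (Fin n → Fin a) → (Fin m → Fin m → Fin a → Bool) →
              Digraph (n * m)
layeredJoin {m = m} A cell label x y = layerArc A cell label (remQuot m x) (remQuot m y)

remQuot-injective : ∀ {n} m (x y : Fin (n * m)) →
  proj₁ (remQuot {n} m x) ≡ proj₁ (remQuot {n} m y) →
  proj₂ (remQuot {n} m x) ≡ proj₂ (remQuot {n} m y) → x ≡ y
remQuot-injective {n} m x y same₁ same₂ =
  trans (sym (combine-remQuot {n} m x)) (trans (cong₂ combine same₁ same₂) (combine-remQuot {n} m y))

module LayeredJoin {n a M j k t λ′ μ size own : ℕ} {A : Digraph n} {cell : Fin n → Fin a}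
  (A-dsrg : IsDSRG n k t λ′ μ A) (equitable : EquitablePartition A cell size own μ)
  (layers : LayerPattern (suc M) a j) where

  open IsDSRG A-dsrg
  open EquitablePartition equitable
  open LayerPattern layers

  m : ℕ
  m = suc M

  link : Fin n × Fin m → Fin n × Fin m → Bool
  link = layerArc A cell label

  β : Fin m → Fin m → Fin n → ℕ
  β r q w = ⟦ label r q (cell w) ⟧

  crossOut : Fin m → Fin m → ℕ
  crossOut r q = count (λ w → label r q (cell w))

  crossIn : Fin m → Fin m → Fin n → ℕ
  crossIn r q v = count (λ w → label r q (cell w) ∧ A w v)

  paths : Fin n → Fin n → ℕ
  paths u v = count (λ w → A u w ∧ A w v)

  link-within : ∀ u w r → link (u , r) (w , r) ≡ A u w
  link-within u w r rewrite ≟-diag r | irreflexive r (cell w) = Bool.∨-identityʳ (A u w)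

  link-across : ∀ u w {r q} → r ≢ q → link (u , r) (w , q) ≡ label r q (cell w)
  link-across u w r≢q rewrite ≟-off r≢q = refl

  linkWeight : ∀ u r w q → ⟦ link (u , r) (w , q) ⟧ ≡ δ r q * ⟦ A u w ⟧ + β r q w
  linkWeight u r w q with r ≟ q
  ... | yes refl rewrite irreflexive r (cell w) | Bool.∨-identityʳ (A u w) =
    sym (trans (+-identityʳ _) (+-identityʳ _))
  ... | no _ = refl

  crossOutSize : ∀ r q → crossOut r q + δ r q * size ≡ size
  crossOutSize r q with r ≟ q
  ... | yes refl = trans (cong (_+ (size + 0)) (count-false (irreflexive r ∘ cell))) (+-identityʳ size)
  ... | no r≢q = let (i , label≗i) = oneCell r q r≢q in
    trans (+-identityʳ _) (trans (count-cong (label≗i ∘ cell)) (cellSize i))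

  crossIn-within : ∀ r v → crossIn r r v ≡ 0
  crossIn-within r v = count-false (λ w → cong (_∧ A w v) (irreflexive r (cell w)))

  crossIn-own : ∀ r s v → label r s (cell v) ≡ true → crossIn r s v ≡ own
  crossIn-own r s v labelled = begin
    crossIn r s v                                ≡⟨ count-cong (λ w → cong (_∧ A w v) (label≗i (cell w))) ⟩
    count (λ w → ⌊ cell w ≟ i ⌋ ∧ A w v)         ≡⟨ cong (λ c → count (λ w → ⌊ cell w ≟ c ⌋ ∧ A w v)) v∈i ⟨
    count (λ w → ⌊ cell w ≟ cell v ⌋ ∧ A w v)    ≡⟨ ownCell v ⟩
    own                                          ∎
    where
    open ≡-Reasoning
    r≢s : r ≢ s
    r≢s refl with () ← trans (sym labelled) (irreflexive r (cell v))
    i : Fin a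
    i = proj₁ (oneCell r s r≢s)
    label≗i : ∀ c → label r s c ≡ ⌊ c ≟ i ⌋
    label≗i = proj₂ (oneCell r s r≢s)
    v∈i : cell v ≡ i
    v∈i = ≟-true (trans (sym (label≗i (cell v))) labelled)

  crossIn-other : ∀ r s v → r ≢ s → label r s (cell v) ≡ false → crossIn r s v ≡ μ
  crossIn-other r s v r≢s unlabelled =
    trans (count-cong (λ w → cong (_∧ A w v) (label≗i (cell w)))) (otherCell v i i≢v)
    where
    i : Fin a
    i = proj₁ (oneCell r s r≢s)
    label≗i : ∀ c → label r s c ≡ ⌊ c ≟ i ⌋
    label≗i = proj₂ (oneCell r s r≢s)
    i≢v : i ≢ cell v
    i≢v i≡v with () ← trans (sym unlabelled)
      (trans (label≗i (cell v)) (trans (cong (λ c → ⌊ cell v ≟ c ⌋) i≡v) (≟-diag (cell v))))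

  walks : Fin n → Fin m → Fin n → Fin m → ℕ
  walks u r v s = sum (λ q → sum (λ w → ⟦ link (u , r) (w , q) ∧ link (w , q) (v , s) ⟧))

  -- The walks through layer q, sorted by which of their two arcs lie inside a
  -- layer: both (a walk of A), the first, the second, or neither.
  layerWalks : ∀ u r v s q →
    sum (λ w → ⟦ link (u , r) (w , q) ∧ link (w , q) (v , s) ⟧)
      ≡ δ r q * (δ q s * paths u v) + δ r q * (β q s v * k) + δ q s * crossIn r q v + β q s v * crossOut r q
  layerWalks u r v s q = begin
    sum (λ w → ⟦ link (u , r) (w , q) ∧ link (w , q) (v , s) ⟧)
      ≡⟨ sum-cong-≗ (λ w → trans (⟦∧⟧ (link (u , r) (w , q)) (link (w , q) (v , s)))
                                  (cong₂ _*_ (linkWeight u r w q) (linkWeight w q v s))) ⟩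
    sum (λ w → (δ r q * ⟦ A u w ⟧ + β r q w) * (δ q s * ⟦ A w v ⟧ + β q s v))
      ≡⟨ ∑-expand (δ r q) (δ q s) (β q s v) (λ w → ⟦ A u w ⟧) (β r q) (λ w → ⟦ A w v ⟧) ⟩
    δ r q * (δ q s * sum (λ w → ⟦ A u w ⟧ * ⟦ A w v ⟧)) + δ r q * (β q s v * sum (λ w → ⟦ A u w ⟧))
      + δ q s * sum (λ w → β r q w * ⟦ A w v ⟧) + β q s v * sum (β r q)
      ≡⟨ cong₂ _+_ (cong₂ _+_ (cong₂ _+_ (cong (λ z → δ r q * (δ q s * z)) pathsSum)
                                          (cong (λ z → δ r q * (β q s v * z)) degreeSum))
                              (cong (δ q s *_) crossInSum))
                   (cong (β q s v *_) crossOutSum) ⟩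
    δ r q * (δ q s * paths u v) + δ r q * (β q s v * k) + δ q s * crossIn r q v + β q s v * crossOut r q
      ∎
    where
    open ≡-Reasoning
    pathsSum : sum (λ w → ⟦ A u w ⟧ * ⟦ A w v ⟧) ≡ paths u v
    pathsSum = sym (count-∧ (A u) (λ w → A w v))
    degreeSum : sum (λ w → ⟦ A u w ⟧) ≡ k
    degreeSum = trans (sym (count≡sum (A u))) (outDegree u)
    crossInSum : sum (λ w → β r q w * ⟦ A w v ⟧) ≡ crossIn r q v
    crossInSum = sym (count-∧ (λ w → label r q (cell w)) (λ w → A w v))
    crossOutSum : sum (β r q) ≡ crossOut r q
    crossOutSum = sym (count≡sum (λ w → label r q (cell w)))

  -- Walks whose both arcs go between layers: for each of the j layers sending
  -- arcs into v's cell of layer s, a whole cell of middle vertices.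
  crossWalks : ∀ r v s → sum (λ q → β q s v * crossOut r q) + β r s v * size ≡ j * size
  crossWalks r v s = begin
    sum (λ q → β q s v * crossOut r q) + β r s v * size
      ≡⟨ cong (sum (λ q → β q s v * crossOut r q) +_) (∑-δˡ r (λ q → β q s v * size)) ⟨
    sum (λ q → β q s v * crossOut r q) + sum (λ q → δ r q * (β q s v * size))
      ≡⟨ ∑-distrib-+ (λ q → β q s v * crossOut r q) (λ q → δ r q * (β q s v * size)) ⟨
    sum (λ q → β q s v * crossOut r q + δ r q * (β q s v * size))
      ≡⟨ sum-cong-≗ (λ q → trans (factor (β q s v) (crossOut r q) (δ r q) size)
                                  (cong (β q s v *_) (crossOutSize r q))) ⟩
    sum (λ q → β q s v * size)
      ≡⟨ ∑-*ʳ size (λ q → β q s v) ⟩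
    sum (λ q → β q s v) * size
      ≡⟨ cong (_* size) (trans (sym (count≡sum (λ q → label q s (cell v)))) (inLayers s (cell v))) ⟩
    j * size
      ∎
    where
    open ≡-Reasoning
    factor : ∀ b c d z → b * c + d * (b * z) ≡ b * (c + d * z)
    factor = solve-∀

  -- The walk count for arbitrary endpoints, from which every DSRG condition of
  -- the join follows: summing `layerWalks` over q, the Kronecker deltas pick out
  -- the layers r and s, and `crossWalks` counts the rest.
  walkCount : ∀ u r v s →
    walks u r v s + β r s v * size ≡ δ r s * paths u v + β r s v * k + crossIn r s v + j * size
  walkCount u r v s = begin
    walks u r v s + β r s v * size
      ≡⟨ cong (_+ β r s v * size) (trans (sum-cong-≗ (layerWalks u r v s)) distrib) ⟩
    sum T₁ + sum T₂ + sum T₃ + sum T₄ + β r s v * size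
      ≡⟨ +-assoc (sum T₁ + sum T₂ + sum T₃) (sum T₄) _ ⟩
    sum T₁ + sum T₂ + sum T₃ + (sum T₄ + β r s v * size)
      ≡⟨ cong₂ _+_ (cong₂ _+_ (cong₂ _+_ (∑-δˡ r (λ q → δ q s * paths u v)) (∑-δˡ r (λ q → β q s v * k)))
                              (∑-δʳ s (λ q → crossIn r q v)))
                   (crossWalks r v s) ⟩
    δ r s * paths u v + β r s v * k + crossIn r s v + j * size
      ∎
    where
    open ≡-Reasoning
    T₁ T₂ T₃ T₄ : Fin m → ℕ
    T₁ q = δ r q * (δ q s * paths u v)
    T₂ q = δ r q * (β q s v * k)
    T₃ q = δ q s * crossIn r q v
    T₄ q = β q s v * crossOut r q
    distrib : sum (λ q → T₁ q + T₂ q + T₃ q + T₄ q) ≡ sum T₁ + sum T₂ + sum T₃ + sum T₄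
    distrib = trans (∑-distrib-+ (λ q → T₁ q + T₂ q + T₃ q) T₄)
                (cong (_+ sum T₄) (trans (∑-distrib-+ (λ q → T₁ q + T₂ q) T₃)
                  (cong (_+ sum T₃) (∑-distrib-+ T₁ T₂))))

  walksWithin : ∀ u r v → walks u r v r ≡ paths u v + j * size
  walksWithin u r v = begin
    walks u r v r
      ≡⟨ +-identityʳ _ ⟨
    walks u r v r + 0
      ≡⟨ cong (λ b → walks u r v r + ⟦ b ⟧ * size) (irreflexive r (cell v)) ⟨
    walks u r v r + β r r v * size
      ≡⟨ walkCount u r v r ⟩
    δ r r * paths u v + β r r v * k + crossIn r r v + j * size
      ≡⟨ cong₂ (λ d c → d * paths u v + β r r v * k + c + j * size) (δ-diag r) (crossIn-within r v) ⟩
    1 * paths u v + β r r v * k + 0 + j * size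
      ≡⟨ cong (λ b → 1 * paths u v + ⟦ b ⟧ * k + 0 + j * size) (irreflexive r (cell v)) ⟩
    1 * paths u v + 0 * k + 0 + j * size
      ≡⟨ simplify (paths u v) k (j * size) ⟩
    paths u v + j * size
      ∎
    where
    open ≡-Reasoning
    simplify : ∀ p k z → 1 * p + 0 * k + 0 + z ≡ p + z
    simplify = solve-∀

  walksAcross : ∀ u r v s → r ≢ s →
    walks u r v s + β r s v * size ≡ β r s v * k + crossIn r s v + j * size
  walksAcross u r v s r≢s =
    trans (walkCount u r v s) (cong (λ d → d * paths u v + β r s v * k + crossIn r s v + j * size) (δ-off r≢s))

  outWeight : ∀ u r q → sum (λ w → ⟦ link (u , r) (w , q) ⟧) ≡ δ r q * k + crossOut r q
  outWeight u r q = begin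
    sum (λ w → ⟦ link (u , r) (w , q) ⟧)            ≡⟨ sum-cong-≗ (λ w → linkWeight u r w q) ⟩
    sum (λ w → δ r q * ⟦ A u w ⟧ + β r q w)          ≡⟨ ∑-distrib-+ (λ w → δ r q * ⟦ A u w ⟧) (β r q) ⟩
    sum (λ w → δ r q * ⟦ A u w ⟧) + sum (β r q)      ≡⟨ cong₂ _+_ (∑-*ˡ (δ r q) (λ w → ⟦ A u w ⟧))
                                                                   (sym (count≡sum (λ w → label r q (cell w)))) ⟩
    δ r q * sum (λ w → ⟦ A u w ⟧) + crossOut r q      ≡⟨ cong (λ z → δ r q * z + crossOut r q)
                                                             (trans (sym (count≡sum (A u))) (outDegree u)) ⟩
    δ r q * k + crossOut r q                         ∎
    where open ≡-Reasoning

  outLinks : ∀ u r → sum (λ q → sum (λ w → ⟦ link (u , r) (w , q) ⟧)) ≡ k + M * size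
  outLinks u r = +-cancelʳ-≡ size _ _ (begin
    sum (λ q → sum (λ w → ⟦ link (u , r) (w , q) ⟧)) + size
      ≡⟨ cong₂ _+_ (sum-cong-≗ (outWeight u r)) (sym (∑-δˡ r (λ _ → size))) ⟩
    sum (λ q → δ r q * k + crossOut r q) + sum (λ q → δ r q * size)
      ≡⟨ ∑-distrib-+ (λ q → δ r q * k + crossOut r q) (λ q → δ r q * size) ⟨
    sum (λ q → δ r q * k + crossOut r q + δ r q * size)
      ≡⟨ sum-cong-≗ (λ q → trans (+-assoc (δ r q * k) (crossOut r q) (δ r q * size))
                                  (cong (δ r q * k +_) (crossOutSize r q))) ⟩
    sum (λ q → δ r q * k + size)
      ≡⟨ ∑-distrib-+ (λ q → δ r q * k) (λ _ → size) ⟩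
    sum (λ q → δ r q * k) + sum {m} (λ _ → size)
      ≡⟨ cong₂ _+_ (∑-δˡ r (λ _ → k)) (∑-const {m} size) ⟩
    k + (size + M * size)
      ≡⟨ regroup k size (M * size) ⟩
    k + M * size + size
      ∎)
    where
    open ≡-Reasoning
    regroup : ∀ x y z → x + (y + z) ≡ x + z + y
    regroup = solve-∀

  inWeight : ∀ v s q → sum (λ w → ⟦ link (w , q) (v , s) ⟧) ≡ δ q s * k + n * β q s v
  inWeight v s q = begin
    sum (λ w → ⟦ link (w , q) (v , s) ⟧)            ≡⟨ sum-cong-≗ (λ w → linkWeight w q v s) ⟩
    sum (λ w → δ q s * ⟦ A w v ⟧ + β q s v)          ≡⟨ ∑-distrib-+ (λ w → δ q s * ⟦ A w v ⟧) (λ _ → β q s v) ⟩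
    sum (λ w → δ q s * ⟦ A w v ⟧) + sum {n} (λ _ → β q s v)
      ≡⟨ cong₂ _+_ (∑-*ˡ (δ q s) (λ w → ⟦ A w v ⟧)) (∑-const {n} (β q s v)) ⟩
    δ q s * sum (λ w → ⟦ A w v ⟧) + n * β q s v      ≡⟨ cong (λ z → δ q s * z + n * β q s v)
                                                             (trans (sym (count≡sum (λ w → A w v))) (inDegree v)) ⟩
    δ q s * k + n * β q s v                          ∎
    where open ≡-Reasoning

  inLinks : ∀ v s → sum (λ q → sum (λ w → ⟦ link (w , q) (v , s) ⟧)) ≡ k + n * j
  inLinks v s = begin
    sum (λ q → sum (λ w → ⟦ link (w , q) (v , s) ⟧))
      ≡⟨ sum-cong-≗ (inWeight v s) ⟩
    sum (λ q → δ q s * k + n * β q s v)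
      ≡⟨ ∑-distrib-+ (λ q → δ q s * k) (λ q → n * β q s v) ⟩
    sum (λ q → δ q s * k) + sum (λ q → n * β q s v)
      ≡⟨ cong₂ _+_ (∑-δʳ s (λ _ → k)) (∑-*ˡ n (λ q → β q s v)) ⟩
    k + n * sum (λ q → β q s v)
      ≡⟨ cong (λ z → k + n * z) (trans (sym (count≡sum (λ q → label q s (cell v)))) (inLayers s (cell v))) ⟩
    k + n * j
      ∎
    where open ≡-Reasoning

  J : Digraph (n * m)
  J = layeredJoin A cell label

  vertexOf : Fin (n * m) → Fin n
  vertexOf x = proj₁ (remQuot {n} m x)

  layerOf : Fin (n * m) → Fin m
  layerOf x = proj₂ (remQuot {n} m x)

  joinWalks : ∀ x y → count (λ z → J x z ∧ J z y) ≡ walks (vertexOf x) (layerOf x) (vertexOf y) (layerOf y)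
  joinWalks x y = count-pairs (λ p → link (remQuot m x) p ∧ link p (remQuot m y))

  module _ {x y : Fin (n * m)} (same : layerOf x ≡ layerOf y) where

    join-within : J x y ≡ A (vertexOf x) (vertexOf y)
    join-within = trans (cong (λ q → link (remQuot m x) (vertexOf y , q)) (sym same))
                        (link-within (vertexOf x) (vertexOf y) (layerOf x))

    joinWalks-within : count (λ z → J x z ∧ J z y) ≡ paths (vertexOf x) (vertexOf y) + j * size
    joinWalks-within = trans (joinWalks x y)
      (trans (cong (walks (vertexOf x) (layerOf x) (vertexOf y)) (sym same))
             (walksWithin (vertexOf x) (layerOf x) (vertexOf y)))

    distinctVertices : x ≢ y → vertexOf x ≢ vertexOf y
    distinctVertices x≢y sameVertex = x≢y (remQuot-injective m x y sameVertex same)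

  module _ {x y : Fin (n * m)} (across : layerOf x ≢ layerOf y) where

    join-across : J x y ≡ label (layerOf x) (layerOf y) (cell (vertexOf y))
    join-across = link-across (vertexOf x) (vertexOf y) across

    joinWalks-across : count (λ z → J x z ∧ J z y) + β (layerOf x) (layerOf y) (vertexOf y) * size
      ≡ β (layerOf x) (layerOf y) (vertexOf y) * k + crossIn (layerOf x) (layerOf y) (vertexOf y) + j * size
    joinWalks-across = trans (cong (_+ β (layerOf x) (layerOf y) (vertexOf y) * size) (joinWalks x y))
      (walksAcross (vertexOf x) (layerOf x) (vertexOf y) (layerOf y) across)

  -- The layered join is a DSRG when the in-degree from other layers, n·j,
  -- equals the out-degree into other layers, M·size, and when k + own = λ′ + size
  -- (so that walks along an arc between layers match those along an arc of A).
  isDSRG : n * j ≡ M * size → k + own ≡ λ′ + size →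
           IsDSRG (n * m) (k + M * size) (t + j * size) (λ′ + j * size) (μ + j * size) J
  isDSRG balance ownBalance = record
    { loopless  = λ x → trans (link-within (vertexOf x) (vertexOf x) (layerOf x)) (loopless (vertexOf x))
    ; outDegree = λ x → trans (count-pairs (link (remQuot m x))) (outLinks (vertexOf x) (layerOf x))
    ; inDegree  = λ y → trans (count-pairs (λ p → link p (remQuot m y)))
                              (trans (inLinks (vertexOf y) (layerOf y)) (cong (k +_) balance))
    ; diag      = λ x → trans (joinWalks-within {x} refl) (cong (_+ j * size) (diag (vertexOf x)))
    ; arc       = arcWalks
    ; nonarc    = nonarcWalks
    }
    where
    open ≡-Reasoning
    swap : ∀ a b c → a + b + c ≡ a + c + b
    swap = solve-∀

    arcWalks : ∀ x y → x ≢ y → J x y ≡ true → count (λ z → J x z ∧ J z y) ≡ λ′ + j * size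
    arcWalks x y x≢y Jxy = [ within , across ]′ (toSum (layerOf x ≟ layerOf y))
      where
      W : ℕ
      W = count (λ z → J x z ∧ J z y)
      r s : Fin m
      r = layerOf x
      s = layerOf y
      v : Fin n
      v = vertexOf y

      within : r ≡ s → W ≡ λ′ + j * size
      within same = trans (joinWalks-within same)
        (cong (_+ j * size) (arc _ _ (distinctVertices same x≢y) (trans (sym (join-within same)) Jxy)))

      across : r ≢ s → W ≡ λ′ + j * size
      across r≢s = +-cancelʳ-≡ size _ _ (begin
        W + size                  ≡⟨ cong (W +_) (*-identityˡ size) ⟨
        W + ⟦ true ⟧ * size       ≡⟨ cong (λ b → W + ⟦ b ⟧ * size) labelled ⟨
        W + β r s v * size        ≡⟨ joinWalks-across r≢s ⟩
        β r s v * k + crossIn r s v + j * size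
          ≡⟨ cong₂ (λ b c → ⟦ b ⟧ * k + c + j * size) labelled (crossIn-own r s v labelled) ⟩
        1 * k + own + j * size    ≡⟨ cong (λ z → z + own + j * size) (*-identityˡ k) ⟩
        k + own + j * size        ≡⟨ cong (_+ j * size) ownBalance ⟩
        λ′ + size + j * size      ≡⟨ swap λ′ size (j * size) ⟩
        λ′ + j * size + size      ∎)
        where
        labelled : label r s (cell v) ≡ true
        labelled = trans (sym (join-across r≢s)) Jxy

    nonarcWalks : ∀ x y → x ≢ y → J x y ≡ false → count (λ z → J x z ∧ J z y) ≡ μ + j * size
    nonarcWalks x y x≢y Jxy = [ within , across ]′ (toSum (layerOf x ≟ layerOf y))
      where
      W : ℕ
      W = count (λ z → J x z ∧ J z y)
      r s : Fin m
      r = layerOf x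
      s = layerOf y
      v : Fin n
      v = vertexOf y

      within : r ≡ s → W ≡ μ + j * size
      within same = trans (joinWalks-within same)
        (cong (_+ j * size) (nonarc _ _ (distinctVertices same x≢y) (trans (sym (join-within same)) Jxy)))

      across : r ≢ s → W ≡ μ + j * size
      across r≢s = begin
        W                         ≡⟨ +-identityʳ W ⟨
        W + ⟦ false ⟧ * size      ≡⟨ cong (λ b → W + ⟦ b ⟧ * size) unlabelled ⟨
        W + β r s v * size        ≡⟨ joinWalks-across r≢s ⟩
        β r s v * k + crossIn r s v + j * size
          ≡⟨ cong₂ (λ b c → ⟦ b ⟧ * k + c + j * size) unlabelled (crossIn-other r s v r≢s unlabelled) ⟩
        μ + j * size              ∎
        where
        unlabelled : label r s (cell v) ≡ false
        unlabelled = trans (sym (join-across r≢s)) Jxy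

piLabel : ∀ a → Fin (suc a) → Fin (suc a) → Fin a → Bool
piLabel a r s c = toℕ s ≡ᵇ ((toℕ r + suc (toℕ c)) % suc a)

piJoin-layered : ∀ {n a} (A : Digraph n) (cell : Fin n → Fin a) →
                 piJoin A cell ≡ layeredJoin A cell (piLabel a)
piJoin-layered A cell = refl

piPattern₅ : LayerPattern 6 5 1
piPattern₅ = record
  { label       = piLabel 5
  ; irreflexive = toWitness {a? = all? λ r → all? λ c → piLabel 5 r r c Bool.≟ false} tt
  ; oneCell     = λ r s r≢s → [ ⊥-elim ∘ r≢s , id ]′ (oneCellOrEqual r s)
  ; inLayers    = toWitness {a? = all? λ s → all? λ c → count (λ r → piLabel 5 r s c) ℕ.≟ 1} tt
  }
  where
  oneCellOrEqual : ∀ r s → r ≡ s ⊎ ∃ λ i → ∀ c → piLabel 5 r s c ≡ ⌊ c ≟ i ⌋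
  oneCellOrEqual = toWitness {a? = all? λ r → all? λ s →
    (r ≟ s) ⊎-dec any? (λ i → all? λ c → piLabel 5 r s c Bool.≟ ⌊ c ≟ i ⌋)} tt

-- b·a + 1 layers: seen from layer s, the other layers are numbered by
-- Fin (b * a), read as pairs in Fin b × Fin a, and the second coordinate is
-- the cell of s that they send arcs into.
blockLabel : ∀ b a → Fin (suc (b * a)) → Fin (suc (b * a)) → Fin a → Bool
blockLabel b a r s c with s ≟ r
... | yes _   = false
... | no s≢r = ⌊ c ≟ proj₂ (remQuot {b} a (punchOut s≢r)) ⌋

module _ (b a : ℕ) where

  blockLabel-diag : ∀ r c → blockLabel b a r r c ≡ false
  blockLabel-diag r c with r ≟ r
  ... | yes _   = refl
  ... | no r≢r = ⊥-elim (r≢r refl)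

  blockLabel-oneCell : ∀ r s → r ≢ s → ∃ λ i → ∀ c → blockLabel b a r s c ≡ ⌊ c ≟ i ⌋
  blockLabel-oneCell r s r≢s with s ≟ r
  ... | yes s≡r = ⊥-elim (r≢s (sym s≡r))
  ... | no s≢r = proj₂ (remQuot {b} a (punchOut s≢r)) , λ c → refl

  blockLabel-punchIn : ∀ s x c → blockLabel b a (punchIn s x) s c ≡ ⌊ c ≟ proj₂ (remQuot {b} a x) ⌋
  blockLabel-punchIn s x c with s ≟ punchIn s x
  ... | yes s≡x = ⊥-elim (punchInᵢ≢i s x (sym s≡x))
  ... | no s≢x = cong (λ z → ⌊ c ≟ proj₂ (remQuot {b} a z) ⌋)
                      (trans (punchOut-cong s refl) (punchOut-punchIn s))

  -- Every cell of layer s receives arcs from one layer per block, so from b layers.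
  blockLabel-inLayers : ∀ s c → count (λ r → blockLabel b a r s c) ≡ b
  blockLabel-inLayers s c = begin
    count (λ r → blockLabel b a r s c)
      ≡⟨ count-remove (λ r → blockLabel b a r s c) s ⟩
    ⟦ blockLabel b a s s c ⟧ + count (λ x → blockLabel b a (punchIn s x) s c)
      ≡⟨ cong₂ _+_ (cong ⟦_⟧ (blockLabel-diag s c)) (count-cong (λ x → blockLabel-punchIn s x c)) ⟩
    count {b * a} (λ x → ⌊ c ≟ proj₂ (remQuot {b} a x) ⌋)
      ≡⟨ count≡sum {b * a} _ ⟩
    sum {b * a} (λ x → δ c (proj₂ (remQuot {b} a x)))
      ≡⟨ ∑-remQuot {b} (λ (_ , y) → δ c y) ⟩
    sum {b} (λ _ → sum (δ c))
      ≡⟨ sum-cong-≗ {b} (λ _ → ∑-δ c) ⟩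
    sum {b} (λ _ → 1)
      ≡⟨ ∑-const {b} 1 ⟩
    b * 1
      ≡⟨ *-identityʳ b ⟩
    b ∎
    where open ≡-Reasoning

  blockPattern : LayerPattern (suc (b * a)) a b
  blockPattern = record
    { label       = blockLabel b a
    ; irreflexive = blockLabel-diag
    ; oneCell     = blockLabel-oneCell
    ; inLayers    = blockLabel-inLayers
    }

petersen-degree : ∀ p → count (λ q → petersen q p) ≡ 3
petersen-degree = toWitness {a? = all? λ p → count (λ q → petersen q p) ℕ.≟ 3} tt

petersen-distance≤2 : ∀ p p' → p ≡ p' ⊎ petersen p p' ≡ true ⊎
                      ∃ λ p'' → petersen p p'' ≡ true × petersen p'' p' ≡ true
petersen-distance≤2 = toWitness {a? = all? λ p → all? λ p' → (p ≟ p') ⊎-dec (petersen p p' Bool.≟ true) ⊎-dec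
  any? (λ p'' → (petersen p p'' Bool.≟ true) ×-dec (petersen p'' p' Bool.≟ true))} tt

petersen-diameter₂ : ∀ p p' → p ≢ p' → petersen p p' ≡ false →
                     ∃ λ p'' → petersen p p'' ≡ true × petersen p'' p' ≡ true
petersen-diameter₂ p p' p≢p' nonadjacent with petersen-distance≤2 p p'
... | inj₁ p≡p'          = ⊥-elim (p≢p' p≡p')
... | inj₂ (inj₁ adjacent) with () ← trans (sym adjacent) nonadjacent
... | inj₂ (inj₂ common)   = common

module HoffmanSingleton (H : Digraph 50) (srg : IsSRG 50 7 0 1 H) (cell : Fin 50 → Fin 5)
                        (copies : ∀ i → InducedPetersenCell H cell i) where
  open IsSRG srg
  open IsDSRG isDSRG

  embed : Fin 5 → Fin 10 → Fin 50
  embed i = proj₁ (copies i)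

  embed-injective : ∀ i {p p'} → embed i p ≡ embed i p' → p ≡ p'
  embed-injective i = proj₁ (proj₂ (copies i))

  embed-cell : ∀ i p → cell (embed i p) ≡ i
  embed-cell i = proj₁ (proj₂ (proj₂ (copies i)))

  embed-onto : ∀ i v → cell v ≡ i → ∃ λ p → embed i p ≡ v
  embed-onto i = proj₁ (proj₂ (proj₂ (proj₂ (copies i))))

  embed-petersen : ∀ i p q → H (embed i p) (embed i q) ≡ petersen p q
  embed-petersen i = proj₂ (proj₂ (proj₂ (proj₂ (copies i))))

  countInCell : ∀ i (g : Fin 50 → Bool) → count (λ w → ⌊ cell w ≟ i ⌋ ∧ g w) ≡ count (g ∘ embed i)
  countInCell i = count-image (embed i) (embed-injective i) (λ w → ⌊ cell w ≟ i ⌋)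
    (λ p → trans (cong (λ c → ⌊ c ≟ i ⌋) (embed-cell i p)) (≟-diag i))
    (λ w w∈i → embed-onto i w (≟-true w∈i))

  cellSize : ∀ i → count (λ w → ⌊ cell w ≟ i ⌋) ≡ 10
  cellSize i = trans (count-cong (λ w → sym (Bool.∧-identityʳ ⌊ cell w ≟ i ⌋))) (countInCell i (λ _ → true))

  ownCell : ∀ v → count (λ w → ⌊ cell w ≟ cell v ⌋ ∧ H w v) ≡ 3
  ownCell v = begin
    count (λ w → ⌊ cell w ≟ cell v ⌋ ∧ H w v)     ≡⟨ countInCell (cell v) (λ w → H w v) ⟩
    count (λ p → H (embed (cell v) p) v)          ≡⟨ count-cong (λ p → cong (H (embed (cell v) p)) (sym p₀↦v)) ⟩
    count (λ p → H (embed (cell v) p) (embed (cell v) p₀))  ≡⟨ count-cong (λ p → embed-petersen (cell v) p p₀) ⟩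
    count (λ p → petersen p p₀)                   ≡⟨ petersen-degree p₀ ⟩
    3                                             ∎
    where
    open ≡-Reasoning
    p₀ : Fin 10
    p₀ = proj₁ (embed-onto (cell v) v refl)
    p₀↦v : embed (cell v) p₀ ≡ v
    p₀↦v = proj₂ (embed-onto (cell v) v refl)

  -- A vertex outside a Petersen copy has at most one neighbour in it: two
  -- would close a triangle or, via the common Petersen neighbour, a 4-cycle.
  outsideNbrs : ∀ v i → i ≢ cell v → count (λ p → H (embed i p) v) ≤ 1
  outsideNbrs v i i≢v = count-≤1 _ (λ p p' vp vp' → decidable-stable (p ≟ p') (noTwo p p' vp vp'))
    where
    e : Fin 10 → Fin 50
    e = embed i
    viaMiddle : Fin 10 → Fin 10 → Fin 50 → Bool
    viaMiddle p p' z = H (e p) z ∧ H z (e p')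
    viaV : ∀ p p' → H (e p) v ≡ true → H (e p') v ≡ true → viaMiddle p p' v ≡ true
    viaV p p' vp vp' = cong₂ _∧_ vp (trans (symmetric v (e p')) vp')
    noTwo : ∀ p p' → H (e p) v ≡ true → H (e p') v ≡ true → p ≢ p' → ⊥
    noTwo p p' vp vp' p≢p' with H (e p) (e p') in adjacency
    ... | true = <⇒≱ (count-≥1 (viaMiddle p p') (viaV p p' vp vp'))
                     (subst (_≤ 0) (sym (arc (e p) (e p') (p≢p' ∘ embed-injective i) adjacency)) z≤n)
    ... | false = <⇒≱ (count-≥2 (viaMiddle p p') {e p''} {v} p''≢v (cong₂ _∧_ pp'' p''p') (viaV p p' vp vp'))
                      (subst (_≤ 1) (sym (nonarc (e p) (e p') (p≢p' ∘ embed-injective i) adjacency)) ≤-refl)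
      where
      common : ∃ λ p'' → petersen p p'' ≡ true × petersen p'' p' ≡ true
      common = petersen-diameter₂ p p' p≢p' (trans (sym (embed-petersen i p p')) adjacency)
      p'' : Fin 10
      p'' = proj₁ common
      pp'' : H (e p) (e p'') ≡ true
      pp'' = trans (embed-petersen i p p'') (proj₁ (proj₂ common))
      p''p' : H (e p'') (e p') ≡ true
      p''p' = trans (embed-petersen i p'' p') (proj₂ (proj₂ common))
      p''≢v : e p'' ≢ v
      p''≢v e≡v = i≢v (trans (sym (embed-cell i p'')) (cong cell e≡v))

  nbrsIn : Fin 5 → Fin 50 → ℕ
  nbrsIn i v = count (λ w → ⌊ cell w ≟ i ⌋ ∧ H w v)

  -- Seven neighbours, three in the own cell and at most one in each of the
  -- four others: so exactly one in each other cell.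
  otherCell : ∀ v i → i ≢ cell v → nbrsIn i v ≡ 1
  otherCell v i i≢v =
    subst (λ c → nbrsIn c v ≡ 1) (punchIn-punchOut v≢i) (saturated others atMostOne fourOthers (punchOut v≢i))
    where
    v≢i : cell v ≢ i
    v≢i = i≢v ∘ sym
    others : Fin 4 → ℕ
    others x = nbrsIn (punchIn (cell v) x) v
    atMostOne : ∀ x → others x ≤ 1
    atMostOne x = subst (_≤ 1) (sym (countInCell (punchIn (cell v) x) (λ w → H w v)))
                        (outsideNbrs v (punchIn (cell v) x) (punchInᵢ≢i (cell v) x))
    fourOthers : sum others ≡ 4
    fourOthers = +-cancelˡ-≡ 3 _ _ (begin
      3 + sum others                   ≡⟨ cong (_+ sum others) (ownCell v) ⟨
      nbrsIn (cell v) v + sum others   ≡⟨ sum-remove {i = cell v} (λ c → nbrsIn c v) ⟨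
      sum (λ c → nbrsIn c v)           ≡⟨ ∑-cells cell (λ w → H w v) ⟩
      count (λ w → H w v)              ≡⟨ inDegree v ⟩
      7                                ∎)
      where open ≡-Reasoning

  equitable : EquitablePartition H cell 10 3 1
  equitable = record { cellSize = cellSize ; ownCell = ownCell ; otherCell = otherCell }

castDSRG : ∀ {N N′ k k′ t t′ l l′ u u′} → N ≡ N′ → k ≡ k′ → t ≡ t′ → l ≡ l′ → u ≡ u′ →
           Σ (Digraph N) (IsDSRG N k t l u) → Σ (Digraph N′) (IsDSRG N′ k′ t′ l′ u′)
castDSRG refl refl refl refl refl D = D

blockBalance : ∀ j → 50 * suc j ≡ suc j * 5 * 10
blockBalance = solve-∀

blockVertices : ∀ j → 50 * suc (suc j * 5) ≡ 250 * suc j + 50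
blockVertices = solve-∀

blockDegree : ∀ j → 7 + suc j * 5 * 10 ≡ 50 * suc j + 7
blockDegree = solve-∀

blockShift : ∀ c j → c + suc j * 10 ≡ 10 * suc j + c
blockShift = solve-∀

mainTheorem19 :
    (H : Digraph 50) → IsSRG 50 7 0 1 H →
    (cell : Fin 50 → Fin 5) → (∀ i → InducedPetersenCell H cell i) →
    IsGood H cell ×
    ((j : ℕ) → Σ (Digraph (250 * suc j + 50)) λ D →
       IsDSRG (250 * suc j + 50) (50 * suc j + 7) (10 * suc j + 7)
              (10 * suc j) (10 * suc j + 1) D)
mainTheorem19 H srg cell copies = good , family
  where
  open HoffmanSingleton H srg cell copies using (equitable)
  H-dsrg : IsDSRG 50 7 7 0 1 H
  H-dsrg = IsSRG.isDSRG srg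

  good : IsGood H cell
  good = _ , _ , _ , _ , subst (IsDSRG 300 57 17 10 11) (sym (piJoin-layered H cell))
                               (LayeredJoin.isDSRG H-dsrg equitable piPattern₅ refl refl)

  family : (j : ℕ) → Σ (Digraph (250 * suc j + 50)) λ D →
    IsDSRG (250 * suc j + 50) (50 * suc j + 7) (10 * suc j + 7) (10 * suc j) (10 * suc j + 1) D
  family j = castDSRG (blockVertices j) (blockDegree j) (blockShift 7 j) (*-comm (suc j) 10) (blockShift 1 j)
    (_ , LayeredJoin.isDSRG H-dsrg equitable (blockPattern (suc j) 5) (blockBalance j) refl)
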